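{- Let $p\geq1$, $r\geq1$ and $n> pr$. Then $$|E(O\Gamma_{n}^{(p,r)})|=\sum^{r}_{t=0}\Big(|E(O\Gamma_{n-tp-1}^{(p,r)})|+t\,|V(O\Gamma_{n-tp-1}^{(p,r)})|\Big).$$
   Context: For integers $m\ge1$ and $p,r\ge1$, $O\Gamma_{m}^{(p,r)}$ is the graph whose vertices are the binary words of length $m$ in which any two $1$s are separated by at least $p-1$ zeros and which contain no factor $(10^{p-1})^{r}1$ (no more than $r$ ones each separated from the next by exactly $p-1$ zeros); two vertices are adjacent iff they differ in exactly one coordinate. By convention $O\Gamma_{0}^{(p,r)}$ is the graph with a single vertex (the empty word) and no edges. $0^s$ denotes a run of $s$ zeros. -}

module Defs where

open import Data.Bool using (Bool; true; false)
open import Data.Bool.Properties using () renaming (_≟_ to _≟B_)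
open import Data.Nat using (ℕ; zero; suc; _∸_; _<_) renaming (_≟_ to _≟ℕ_)
open import Data.List using (List; []; _∷_; _++_; [_]; replicate; concat; map; filter; length; upTo; zipWith)
open import Data.Nat.ListAction using (sum)
open import Data.List.Relation.Binary.Infix.Heterogeneous using (Infix)
open import Data.List.Relation.Binary.Infix.Heterogeneous.Properties using (infix?)
open import Data.List.Relation.Unary.All using (All)
open import Data.List.Relation.Unary.All using () renaming (all? to All?)
open import Relation.Binary.PropositionalEquality using (_≡_)
open import Relation.Nullary using (¬_; Dec; yes; no)
open import Relation.Nullary.Decidable using (¬?; _×-dec_)
open import Data.Product using (_×_; _,_)

-- Binary words are lists of booleans (true = 1, false = 0).
Word : Set
Word = List Bool

_IsFactorOf_ : Word → Word → Set
u IsFactorOf w = Infix _≡_ u w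

factor? : (u w : Word) → Dec (u IsFactorOf w)
factor? = infix? _≟B_

words : ℕ → List Word
words zero    = [ [] ]
words (suc m) = map (false ∷_) (words m) ++ map (true ∷_) (words m)

one-zeros-one : ℕ → Word
one-zeros-one s = true ∷ replicate s false ++ [ true ]

-- any two 1s are separated by at least p-1 zeros:
-- no factor 1 0^s 1 with s < p-1
Separated : ℕ → Word → Set
Separated p w = All (λ s → ¬ (one-zeros-one s IsFactorOf w)) (upTo (p ∸ 1))

forbidden : ℕ → ℕ → Word
forbidden p r = concat (replicate r (true ∷ replicate (p ∸ 1) false)) ++ [ true ]

IsVertex : ℕ → ℕ → Word → Set
IsVertex p r w = Separated p w × ¬ (forbidden p r IsFactorOf w)

isVertex? : (p r : ℕ) (w : Word) → Dec (IsVertex p r w)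
isVertex? p r w =
  All? (λ s → ¬? (factor? (one-zeros-one s) w)) (upTo (p ∸ 1))
  ×-dec ¬? (factor? (forbidden p r) w)

vertices : ℕ → ℕ → ℕ → List Word
vertices p r m = filter (isVertex? p r) (words m)

hamming : Word → Word → ℕ
hamming [] _ = 0
hamming (_ ∷ _) [] = 0
hamming (x ∷ xs) (y ∷ ys) with x ≟B y
... | yes _ = hamming xs ys
... | no  _ = suc (hamming xs ys)

pairs : {A : Set} → List A → List (A × A)
pairs []       = []
pairs (x ∷ xs) = map (x ,_) xs ++ pairs xs

Adjacent : Word × Word → Set
Adjacent (u , v) = hamming u v ≡ 1

adjacent? : (e : Word × Word) → Dec (Adjacent e)
adjacent? (u , v) = (hamming u v) ≟ℕ 1

edges : ℕ → ℕ → ℕ → List (Word × Word)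
edges p r m = filter adjacent? (pairs (vertices p r m))

numV : ℕ → ℕ → ℕ → ℕ
numV p r m = length (vertices p r m)

numE : ℕ → ℕ → ℕ → ℕ
numE p r m = length (edges p r m)

sumTo : ℕ → (ℕ → ℕ) → ℕ
sumTo r f = sum (map f (upTo (suc r)))

-- Write B = 10^{p-1} and, for s ≤ r, let V_s(m), E_s(m) be the numbers of vertices and edges of
-- the subgraph of the m-cube induced by the words u such that B^s u is a vertex of OΓ^{(p,r)};
-- V_0, E_0 are |V(OΓ_m)|, |E(OΓ_m)|. Split on the first letter of u. After B^s a leading 0 can
-- be dropped (B^s 0 u is a vertex iff u is), a leading 1 must be followed by p-1 zeros and
-- then continues as a word counted by V_{s+1}, and for s = r a leading 1 is impossible. The edges
-- between the two halves join 0u to 1u, and 1u counted forces 0u counted, so there are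
-- V_{s+1}(m-p) of them. Hence V_s(m) = |V(OΓ_{m-1})| + V_{s+1}(m-p) and
-- E_s(m) = |E(OΓ_{m-1})| + V_{s+1}(m-p) + E_{s+1}(m-p); unrolling from s = 0 to s = r gives the sum.

module Submission where

open import Defs
open import Relation.Binary.PropositionalEquality using (_≡_)
open import Data.Nat using (ℕ; _+_; _*_; _∸_; _<_; _≤_)

open import Data.Bool using (Bool; true; false; _∧_; if_then_else_)
open import Data.Bool.Properties using (∧-zeroʳ)
open import Data.Nat using (zero; suc; _≡ᵇ_; z≤n; s≤s)
open import Data.Nat.Properties
  using ( +-assoc; +-suc; +-identityʳ; *-comm; ≤-refl; ≤-trans; m≤m+n; m≤n⇒m≤1+n
        ; [m+n]∸[m+o]≡n∸o; +-commutativeSemigroup)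
open import Data.Nat.ListAction using (sum)
open import Data.Nat.Tactic.RingSolver using (solve-∀)
open import Data.List using (List; []; _∷_; _++_; [_]; replicate; concat; map; filter; length; upTo)
open import Data.List.Properties using (++-assoc; ++-identityʳ; map-applyUpTo; map-cong)
open import Data.List.Relation.Unary.All as All using (All; []; _∷_)
import Data.List.Relation.Unary.All.Properties as Allₚ
open import Data.List.Membership.Propositional.Properties using (∈-upTo⁺)
open import Data.List.Relation.Binary.Infix.Heterogeneous using (here; there)
open import Data.List.Relation.Binary.Prefix.Heterogeneous using (Prefix; []; _∷_)
import Data.List.Relation.Binary.Prefix.Heterogeneous.Properties as Prefix
open import Data.Product using (Σ; _×_; _,_; proj₁; proj₂)
open import Function using (_∘_; mk⇔)
open import Algebra.Properties.CommutativeSemigroup +-commutativeSemigroup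
  using (interchange; x∙yz≈y∙xz)
open import Relation.Binary.PropositionalEquality
  using (refl; sym; trans; cong; cong₂; subst; subst₂; module ≡-Reasoning)
open import Data.Empty using (⊥-elim)
open import Relation.Nullary using (Dec; yes; no; does; ¬_)
open import Relation.Nullary.Decidable using (dec-true; dec-false; does-⇔)

private variable A B : Set

m+n<o⇒∃[o′]o≡m+o′×n<o′ : ∀ m {n o} → m + n < o → Σ ℕ λ o′ → o ≡ m + o′ × n < o′
m+n<o⇒∃[o′]o≡m+o′×n<o′ zero n<o = _ , refl , n<o
m+n<o⇒∃[o′]o≡m+o′×n<o′ (suc m) {o = suc o} (s≤s m+n<o)
  with m+n<o⇒∃[o′]o≡m+o′×n<o′ m m+n<o
... | o′ , refl , n<o′ = o′ , refl , n<o′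

sumTo-suc : ∀ k (f : ℕ → ℕ) → sumTo (suc k) f ≡ f 0 + sumTo k (f ∘ suc)
sumTo-suc k f = cong (λ xs → f 0 + sum xs)
  (trans (map-applyUpTo suc f (suc k)) (sym (map-applyUpTo (λ t → t) (f ∘ suc) (suc k))))

sumTo-cong : ∀ k {f g : ℕ → ℕ} → (∀ t → f t ≡ g t) → sumTo k f ≡ sumTo k g
sumTo-cong k f≗g = cong sum (map-cong f≗g (upTo (suc k)))

sum-map-+ : ∀ (f g : A → ℕ) xs →
  sum (map (λ x → f x + g x) xs) ≡ sum (map f xs) + sum (map g xs)
sum-map-+ f g [] = refl
sum-map-+ f g (x ∷ xs) = trans (cong (f x + g x +_) (sum-map-+ f g xs)) (interchange (f x) (g x) _ _)

does-∧-implied : ∀ {P Q : Set} (P? : Dec P) (Q? : Dec Q) → (Q → P) →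
  does P? ∧ does Q? ≡ does Q?
does-∧-implied P? (yes q) Q→P = cong (_∧ true) (dec-true P? (Q→P q))
does-∧-implied P? (no _)  _   = ∧-zeroʳ (does P?)

count : (A → Bool) → List A → ℕ
count f [] = 0
count f (x ∷ xs) = (if f x then 1 else 0) + count f xs

count-cong : ∀ {f g : A → Bool} → (∀ x → f x ≡ g x) → ∀ xs → count f xs ≡ count g xs
count-cong f≗g [] = refl
count-cong f≗g (x ∷ xs) = cong₂ (λ b n → (if b then 1 else 0) + n) (f≗g x) (count-cong f≗g xs)

count-none : ∀ {f : A → Bool} → (∀ x → f x ≡ false) → ∀ xs → count f xs ≡ 0
count-none none [] = refl
count-none none (x ∷ xs) rewrite none x = count-none none xs

count-++ : ∀ (f : A → Bool) xs ys → count f (xs ++ ys) ≡ count f xs + count f ys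
count-++ f [] ys = refl
count-++ f (x ∷ xs) ys =
  trans (cong (_ +_) (count-++ f xs ys)) (sym (+-assoc (if f x then 1 else 0) _ _))

count-map : ∀ (f : B → Bool) (g : A → B) xs → count f (map g xs) ≡ count (f ∘ g) xs
count-map f g [] = refl
count-map f g (x ∷ xs) = cong (_ +_) (count-map f g xs)

module _ {P : A → Set} (P? : ∀ x → Dec (P x)) where

  length-filter : ∀ xs → length (filter P? xs) ≡ count (does ∘ P?) xs
  length-filter [] = refl
  length-filter (x ∷ xs) with does (P? x)
  ... | true  = cong suc (length-filter xs)
  ... | false = length-filter xs

  count-filter : ∀ (f : A → Bool) xs →
    count f (filter P? xs) ≡ count (λ x → does (P? x) ∧ f x) xs
  count-filter f [] = refl
  count-filter f (x ∷ xs) with does (P? x)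
  ... | true  = cong (_ +_) (count-filter f xs)
  ... | false = count-filter f xs

onBoth : (A → Bool) → (A × A → Bool) → A × A → Bool
onBoth f h e = f (proj₁ e) ∧ (f (proj₂ e) ∧ h e)

count-pairs-filter : ∀ {P : A → Set} (P? : ∀ x → Dec (P x)) (h : A × A → Bool) xs →
  count h (pairs (filter P? xs)) ≡ count (onBoth (does ∘ P?) h) (pairs xs)
count-pairs-filter P? h [] = refl
count-pairs-filter P? h (x ∷ xs) with does (P? x) in Px
... | true = begin
  count h (map (x ,_) (filter P? xs) ++ pairs (filter P? xs))
    ≡⟨ count-++ h (map (x ,_) (filter P? xs)) _ ⟩
  count h (map (x ,_) (filter P? xs)) + count h (pairs (filter P? xs))
    ≡⟨ cong₂ _+_ row (count-pairs-filter P? h xs) ⟩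
  count (onBoth (does ∘ P?) h) (map (x ,_) xs) + count (onBoth (does ∘ P?) h) (pairs xs)
    ≡⟨ count-++ (onBoth (does ∘ P?) h) (map (x ,_) xs) _ ⟨
  count (onBoth (does ∘ P?) h) (map (x ,_) xs ++ pairs xs) ∎
  where
  open ≡-Reasoning
  row : count h (map (x ,_) (filter P? xs)) ≡ count (onBoth (does ∘ P?) h) (map (x ,_) xs)
  row = begin
    count h (map (x ,_) (filter P? xs))            ≡⟨ count-map h (x ,_) (filter P? xs) ⟩
    count (λ y → h (x , y)) (filter P? xs)         ≡⟨ count-filter P? _ xs ⟩
    count (λ y → does (P? y) ∧ h (x , y)) xs
      ≡⟨ count-cong (λ y → cong (_∧ (does (P? y) ∧ h (x , y))) Px) xs ⟨
    count (λ y → onBoth (does ∘ P?) h (x , y)) xs  ≡⟨ count-map _ (x ,_) xs ⟨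
    count (onBoth (does ∘ P?) h) (map (x ,_) xs)   ∎
... | false = begin
  count h (pairs (filter P? xs))
    ≡⟨ count-pairs-filter P? h xs ⟩
  count (onBoth (does ∘ P?) h) (pairs xs)
    ≡⟨ cong (_+ _) row ⟨
  count (onBoth (does ∘ P?) h) (map (x ,_) xs) + count (onBoth (does ∘ P?) h) (pairs xs)
    ≡⟨ count-++ (onBoth (does ∘ P?) h) (map (x ,_) xs) _ ⟨
  count (onBoth (does ∘ P?) h) (map (x ,_) xs ++ pairs xs) ∎
  where
  open ≡-Reasoning
  row : count (onBoth (does ∘ P?) h) (map (x ,_) xs) ≡ 0
  row = trans (count-map _ (x ,_) xs) (count-none (λ y → cong (_∧ (does (P? y) ∧ h (x , y))) Px) xs)

crossCount : (A × B → Bool) → List A → List B → ℕ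
crossCount h [] ys = 0
crossCount h (x ∷ xs) ys = count (λ y → h (x , y)) ys + crossCount h xs ys

count-pairs-++ : ∀ (h : A × A → Bool) xs ys →
  count h (pairs (xs ++ ys)) ≡ count h (pairs xs) + crossCount h xs ys + count h (pairs ys)
count-pairs-++ h [] ys = refl
count-pairs-++ h (x ∷ xs) ys = begin
  count h (map (x ,_) (xs ++ ys) ++ pairs (xs ++ ys))
    ≡⟨ count-++ h (map (x ,_) (xs ++ ys)) _ ⟩
  count h (map (x ,_) (xs ++ ys)) + count h (pairs (xs ++ ys))
    ≡⟨ cong₂ _+_ (trans (count-map h (x ,_) (xs ++ ys)) (count-++ _ xs ys)) (count-pairs-++ h xs ys) ⟩
  (row xs + row ys) + (count h (pairs xs) + crossCount h xs ys + count h (pairs ys))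
    ≡⟨ regroup (row xs) (row ys) _ _ _ ⟩
  (row xs + count h (pairs xs)) + (row ys + crossCount h xs ys) + count h (pairs ys)
    ≡⟨ cong (λ n → n + (row ys + crossCount h xs ys) + count h (pairs ys)) row-xs ⟨
  count h (map (x ,_) xs ++ pairs xs) + (row ys + crossCount h xs ys) + count h (pairs ys) ∎
  where
  open ≡-Reasoning
  row : List _ → ℕ
  row = count (λ y → h (x , y))
  row-xs : count h (map (x ,_) xs ++ pairs xs) ≡ row xs + count h (pairs xs)
  row-xs = trans (count-++ h (map (x ,_) xs) _) (cong (_+ _) (count-map h (x ,_) xs))
  regroup : ∀ a b c d e → (a + b) + (c + d + e) ≡ (a + c) + (b + d) + e
  regroup = solve-∀

count-pairs-map : ∀ (h : B × B → Bool) (g : A → B) xs →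
  count h (pairs (map g xs)) ≡ count (λ e → h (g (proj₁ e) , g (proj₂ e))) (pairs xs)
count-pairs-map h g [] = refl
count-pairs-map h g (x ∷ xs) = begin
  count h (map (g x ,_) (map g xs) ++ pairs (map g xs))
    ≡⟨ count-++ h (map (g x ,_) (map g xs)) _ ⟩
  count h (map (g x ,_) (map g xs)) + count h (pairs (map g xs))
    ≡⟨ cong₂ _+_ row (count-pairs-map h g xs) ⟩
  count h′ (map (x ,_) xs) + count h′ (pairs xs)
    ≡⟨ count-++ h′ (map (x ,_) xs) _ ⟨
  count h′ (map (x ,_) xs ++ pairs xs) ∎
  where
  open ≡-Reasoning
  h′ = λ e → h (g (proj₁ e) , g (proj₂ e))
  row : count h (map (g x ,_) (map g xs)) ≡ count h′ (map (x ,_) xs)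
  row = trans (count-map h _ (map g xs))
    (trans (count-map _ g xs) (sym (count-map h′ (x ,_) xs)))

crossCount-map : ∀ {C D : Set} (h : C × D → Bool) (g : A → C) (g′ : B → D) xs ys →
  crossCount h (map g xs) (map g′ ys) ≡ crossCount (λ e → h (g (proj₁ e) , g′ (proj₂ e))) xs ys
crossCount-map h g g′ [] ys = refl
crossCount-map h g g′ (x ∷ xs) ys = cong₂ _+_ (count-map _ g′ ys) (crossCount-map h g g′ xs ys)

crossCount-rows : ∀ {P : A → Set} {h : A × B → Bool} {g : A → Bool} {xs} ys →
  (∀ {x} → P x → count (λ y → h (x , y)) ys ≡ (if g x then 1 else 0)) →
  All P xs → crossCount h xs ys ≡ count g xs
crossCount-rows ys row [] = refl
crossCount-rows ys row (Px ∷ Pxs) = cong₂ _+_ (row Px) (crossCount-rows ys row Pxs)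

words-length : ∀ m → All (λ w → length w ≡ m) (words m)
words-length zero = refl ∷ []
words-length (suc m) = Allₚ.++⁺ (Allₚ.map⁺ lengths) (Allₚ.map⁺ lengths)
  where lengths = All.map (cong suc) (words-length m)

adjacent : Word × Word → Bool
adjacent = does ∘ adjacent?

vertexCount : (Word → Bool) → ℕ → ℕ
vertexCount f m = count f (words m)

edgeCount : (Word → Bool) → ℕ → ℕ
edgeCount f m = count (onBoth f adjacent) (pairs (words m))

isVertexᵇ : ℕ → ℕ → Word → Bool
isVertexᵇ p r = does ∘ isVertex? p r

numV≡vertexCount : ∀ p r m → numV p r m ≡ vertexCount (isVertexᵇ p r) m
numV≡vertexCount p r m = length-filter (isVertex? p r) (words m)

numE≡edgeCount : ∀ p r m → numE p r m ≡ edgeCount (isVertexᵇ p r) m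
numE≡edgeCount p r m = trans (length-filter adjacent? (pairs (vertices p r m)))
  (count-pairs-filter (isVertex? p r) adjacent (words m))

vertexCount-cong : ∀ {f g} → (∀ w → f w ≡ g w) → ∀ m → vertexCount f m ≡ vertexCount g m
vertexCount-cong f≗g m = count-cong f≗g (words m)

edgeCount-cong : ∀ {f g} → (∀ w → f w ≡ g w) → ∀ m → edgeCount f m ≡ edgeCount g m
edgeCount-cong f≗g m = count-cong
  (λ e → cong₂ (λ a b → a ∧ (b ∧ adjacent e)) (f≗g (proj₁ e)) (f≗g (proj₂ e))) (pairs (words m))

vertexCount-suc : ∀ f m →
  vertexCount f (suc m) ≡ vertexCount (f ∘ (false ∷_)) m + vertexCount (f ∘ (true ∷_)) m
vertexCount-suc f m = trans (count-++ f (map (false ∷_) (words m)) _)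
  (cong₂ _+_ (count-map f _ (words m)) (count-map f _ (words m)))

vertexCount-hamming≡0 : ∀ (c : Word → Bool) {m} u → length u ≡ m →
  vertexCount (λ v → c v ∧ (hamming u v ≡ᵇ 0)) m ≡ (if c u then 1 else 0)
vertexCount-hamming≡0 c {zero} [] refl with c []
... | true  = refl
... | false = refl
vertexCount-hamming≡0 c {suc m} (false ∷ u) refl = trans (vertexCount-suc _ m)
  (trans (cong₂ _+_ (vertexCount-hamming≡0 (c ∘ (false ∷_)) u refl)
                    (count-none (λ v → ∧-zeroʳ (c (true ∷ v))) (words m)))
         (+-identityʳ _))
vertexCount-hamming≡0 c {suc m} (true ∷ u) refl = trans (vertexCount-suc _ m)
  (cong₂ _+_ (count-none (λ v → ∧-zeroʳ (c (false ∷ v))) (words m))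
             (vertexCount-hamming≡0 (c ∘ (true ∷_)) u refl))

edgeCount-suc : ∀ f m → edgeCount f (suc m) ≡
  edgeCount (f ∘ (false ∷_)) m + vertexCount (λ u → f (false ∷ u) ∧ f (true ∷ u)) m
    + edgeCount (f ∘ (true ∷_)) m
edgeCount-suc f m = begin
  count E (pairs (W₀ ++ W₁))
    ≡⟨ count-pairs-++ E W₀ W₁ ⟩
  count E (pairs W₀) + crossCount E W₀ W₁ + count E (pairs W₁)
    ≡⟨ cong₂ (λ a b → a + crossCount E W₀ W₁ + b)
         (count-pairs-map E _ (words m)) (count-pairs-map E _ (words m)) ⟩
  edgeCount (f ∘ (false ∷_)) m + crossCount E W₀ W₁ + edgeCount (f ∘ (true ∷_)) m
    ≡⟨ cong (λ n → edgeCount (f ∘ (false ∷_)) m + n + edgeCount (f ∘ (true ∷_)) m) cross ⟩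
  edgeCount (f ∘ (false ∷_)) m + vertexCount (λ u → f (false ∷ u) ∧ f (true ∷ u)) m
    + edgeCount (f ∘ (true ∷_)) m ∎
  where
  open ≡-Reasoning
  E = onBoth f adjacent
  W₀ = map (false ∷_) (words m)
  W₁ = map (true ∷_) (words m)
  -- 0u and 1v are adjacent exactly when u = v
  row : ∀ {u} → length u ≡ m →
    count (λ v → E (false ∷ u , true ∷ v)) (words m) ≡ (if f (false ∷ u) ∧ f (true ∷ u) then 1 else 0)
  row {u} |u| with f (false ∷ u)
  ... | true  = vertexCount-hamming≡0 (f ∘ (true ∷_)) u |u|
  ... | false = count-none (λ _ → refl) (words m)
  cross : crossCount E W₀ W₁ ≡ vertexCount (λ u → f (false ∷ u) ∧ f (true ∷ u)) m
  cross = trans (crossCount-map E _ _ (words m) (words m))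
    (crossCount-rows (words m) row (words-length m))

module _ {f : Word → Bool} (no-head-1 : ∀ w → f (true ∷ w) ≡ false) where

  vertexCount-head-0 : ∀ m → vertexCount f (suc m) ≡ vertexCount (f ∘ (false ∷_)) m
  vertexCount-head-0 m = trans (vertexCount-suc f m)
    (trans (cong (vertexCount (f ∘ (false ∷_)) m +_) (count-none no-head-1 (words m))) (+-identityʳ _))

  edgeCount-head-0 : ∀ m → edgeCount f (suc m) ≡ edgeCount (f ∘ (false ∷_)) m
  edgeCount-head-0 m = begin
    edgeCount f (suc m)
      ≡⟨ edgeCount-suc f m ⟩
    edgeCount (f ∘ (false ∷_)) m + vertexCount (λ u → f (false ∷ u) ∧ f (true ∷ u)) m
      + edgeCount (f ∘ (true ∷_)) m
      ≡⟨ cong₂ (λ a b → edgeCount (f ∘ (false ∷_)) m + a + b) no-cross no-1-edges ⟩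
    edgeCount (f ∘ (false ∷_)) m + 0 + 0
      ≡⟨ trans (+-identityʳ _) (+-identityʳ _) ⟩
    edgeCount (f ∘ (false ∷_)) m ∎
    where
    open ≡-Reasoning
    no-cross : vertexCount (λ u → f (false ∷ u) ∧ f (true ∷ u)) m ≡ 0
    no-cross = count-none (λ u → trans (cong (f (false ∷ u) ∧_) (no-head-1 u)) (∧-zeroʳ _)) (words m)
    no-1-edges : edgeCount (f ∘ (true ∷_)) m ≡ 0
    no-1-edges = count-none (λ e → cong (_∧ (f (true ∷ proj₂ e) ∧ adjacent e)) (no-head-1 (proj₁ e)))
      (pairs (words m))

RejectsEarlyOne : ℕ → (Word → Bool) → Set
RejectsEarlyOne a f = ∀ {i} → i < a → ∀ w → f (replicate i false ++ true ∷ w) ≡ false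

vertexCount-zeros : ∀ a {f} → RejectsEarlyOne a f → ∀ m →
  vertexCount f (a + m) ≡ vertexCount (f ∘ (replicate a false ++_)) m
vertexCount-zeros zero rejects m = refl
vertexCount-zeros (suc a) {f} rejects m =
  trans (vertexCount-head-0 {f} (rejects (s≤s z≤n)) (a + m))
        (vertexCount-zeros a {f ∘ (false ∷_)} (λ i<a → rejects (s≤s i<a)) m)

edgeCount-zeros : ∀ a {f} → RejectsEarlyOne a f → ∀ m →
  edgeCount f (a + m) ≡ edgeCount (f ∘ (replicate a false ++_)) m
edgeCount-zeros zero rejects m = refl
edgeCount-zeros (suc a) {f} rejects m =
  trans (edgeCount-head-0 {f} (rejects (s≤s z≤n)) (a + m))
        (edgeCount-zeros a {f ∘ (false ∷_)} (λ i<a → rejects (s≤s i<a)) m)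

prefix-++ : ∀ (x w : Word) → Prefix _≡_ x (x ++ w)
prefix-++ [] w = []
prefix-++ (b ∷ x) w = refl ∷ prefix-++ x w

factor-++ˡ : ∀ {x u : Word} q → x IsFactorOf u → x IsFactorOf (q ++ u)
factor-++ˡ [] x⊑u = x⊑u
factor-++ˡ (_ ∷ q) x⊑u = there (factor-++ˡ q x⊑u)

factor-zeros⁻ : ∀ {x : Word} → (∀ w → ¬ Prefix _≡_ x (false ∷ w)) →
  ∀ k {u} → x IsFactorOf (replicate k false ++ u) → x IsFactorOf u
factor-zeros⁻ no-lead-0 zero x⊑u = x⊑u
factor-zeros⁻ no-lead-0 (suc k) (here x≼0w) = ⊥-elim (no-lead-0 _ x≼0w)
factor-zeros⁻ no-lead-0 (suc k) (there x⊑u) = factor-zeros⁻ no-lead-0 k x⊑u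

zeros-one-not-prefix : ∀ {i k w} → i < k →
  ¬ Prefix _≡_ (replicate i false ++ [ true ]) (replicate k false ++ w)
zeros-one-not-prefix {zero} {suc k} i<k (() ∷ _)
zeros-one-not-prefix {suc i} {suc k} (s≤s i<k) (_ ∷ pf) = zeros-one-not-prefix i<k pf

module Blocks (p′ r : ℕ) where

  p : ℕ
  p = suc p′

  block : Word
  block = true ∷ replicate p′ false

  blocks : ℕ → Word
  blocks s = concat (replicate s block)

  blocks-∷ʳ : ∀ s → blocks s ++ block ≡ blocks (suc s)
  blocks-∷ʳ zero = sym (++-identityʳ block)
  blocks-∷ʳ (suc s) = trans (++-assoc block (blocks s) block) (cong (block ++_) (blocks-∷ʳ s))

  -- The case j = 0 says that x does not begin with 0.
  AvoidsBlockStarts : ℕ → Word → Set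
  AvoidsBlockStarts s x = ∀ {j} → j ≤ s → ∀ w → ¬ Prefix _≡_ x (blocks j ++ false ∷ w)

  factor-blocks-0⁻ : ∀ {x} s → AvoidsBlockStarts s x →
    ∀ {u} → x IsFactorOf (blocks s ++ false ∷ u) → x IsFactorOf u
  factor-blocks-0⁻ zero avoids (here x≼0u) = ⊥-elim (avoids z≤n _ x≼0u)
  factor-blocks-0⁻ zero avoids (there x⊑u) = x⊑u
  factor-blocks-0⁻ {x} (suc s) avoids {u} x⊑ = strip-block (subst (x IsFactorOf_) assoc x⊑)
    where
    assoc = ++-assoc block (blocks s) (false ∷ u)
    strip-block : x IsFactorOf (true ∷ replicate p′ false ++ blocks s ++ false ∷ u) → x IsFactorOf u
    strip-block (here x≼) = ⊥-elim (avoids ≤-refl u (subst (Prefix _≡_ x) (sym assoc) x≼))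
    strip-block (there x⊑) = factor-blocks-0⁻ s (λ j≤s → avoids (m≤n⇒m≤1+n j≤s))
      (factor-zeros⁻ (avoids z≤n) p′ x⊑)

  short-gap-avoids : ∀ {i} → i < p′ → ∀ s → AvoidsBlockStarts s (one-zeros-one i)
  short-gap-avoids i<p′ s {zero} _ w (() ∷ _)
  short-gap-avoids i<p′ s {suc j} _ w x≼
    with subst (Prefix _≡_ _) (++-assoc block (blocks j) (false ∷ w)) x≼
  ... | _ ∷ x≼′ = zeros-one-not-prefix i<p′ x≼′

  blocks-one-not-prefix : ∀ a b → b ≤ a → ∀ w →
    ¬ Prefix _≡_ (blocks a ++ [ true ]) (blocks b ++ false ∷ w)
  blocks-one-not-prefix zero    zero    _ w (() ∷ _)
  blocks-one-not-prefix (suc a) zero    _ w (() ∷ _)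
  blocks-one-not-prefix (suc a) (suc b) (s≤s b≤a) w x≼ = blocks-one-not-prefix a b b≤a w
    (Prefix.++⁻ {as = block} {bs = block} refl
      (subst₂ (Prefix _≡_) (++-assoc block (blocks a) [ true ]) (++-assoc block (blocks b) (false ∷ w)) x≼))

  forbidden-avoids : ∀ {s} → s ≤ r → AvoidsBlockStarts s (forbidden p r)
  forbidden-avoids s≤r j≤s = blocks-one-not-prefix r _ (≤-trans j≤s s≤r)

  Vertex : Word → Set
  Vertex = IsVertex p r

  isV : Word → Bool
  isV = isVertexᵇ p r

  vertex-blocks-0 : ∀ {s u} → s ≤ r → Vertex u → Vertex (blocks s ++ false ∷ u)
  vertex-blocks-0 {s} s≤r (separated , no-forbidden) =
    All.zipWith (λ (i<p′ , no-gap) → no-gap ∘ factor-blocks-0⁻ s (short-gap-avoids i<p′ s))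
                (Allₚ.all-upTo p′ , separated) ,
    no-forbidden ∘ factor-blocks-0⁻ s (forbidden-avoids s≤r)

  vertex-suffix : ∀ q {u} → Vertex (q ++ u) → Vertex u
  vertex-suffix q (separated , no-forbidden) =
    All.map (_∘ factor-++ˡ q) separated , no-forbidden ∘ factor-++ˡ q

  isV-blocks-0 : ∀ {s} → s ≤ r → ∀ u → isV (blocks s ++ false ∷ u) ≡ isV u
  isV-blocks-0 {s} s≤r u = does-⇔ (mk⇔ from (vertex-blocks-0 s≤r)) (isVertex? p r _) (isVertex? p r u)
    where
    from : Vertex (blocks s ++ false ∷ u) → Vertex u
    from = vertex-suffix (blocks s ++ [ false ]) ∘ subst Vertex (sym (++-assoc (blocks s) [ false ] u))

  isV-∧-suffix : ∀ q u → isV u ∧ isV (q ++ u) ≡ isV (q ++ u)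
  isV-∧-suffix q u = does-∧-implied (isVertex? p r u) (isVertex? p r (q ++ u)) (vertex-suffix q)

  isV-short-gap : ∀ {i} → i < p′ → ∀ q w → isV (q ++ true ∷ replicate i false ++ true ∷ w) ≡ false
  isV-short-gap {i} i<p′ q w = dec-false (isVertex? p r _) λ (separated , _) →
    All.lookup separated (∈-upTo⁺ i<p′)
      (subst (one-zeros-one i IsFactorOf_) gap-in-place (factor-++ˡ q (here (prefix-++ (one-zeros-one i) w))))
    where
    gap-in-place : q ++ one-zeros-one i ++ w ≡ q ++ true ∷ replicate i false ++ true ∷ w
    gap-in-place = cong (λ z → q ++ true ∷ z) (++-assoc (replicate i false) [ true ] w)

  isV-blocks-1 : ∀ u → isV (blocks r ++ true ∷ u) ≡ false
  isV-blocks-1 u = dec-false (isVertex? p r _) λ (_ , no-forbidden) →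
    no-forbidden (subst (_ IsFactorOf_) (++-assoc (blocks r) [ true ] u) (here (prefix-++ (forbidden p r) u)))

  afterBlocks : ℕ → Word → Bool
  afterBlocks s u = isV (blocks s ++ u)

  afterBlocks-1 : ∀ s u → afterBlocks s (true ∷ replicate p′ false ++ u) ≡ afterBlocks (suc s) u
  afterBlocks-1 s u = cong isV (trans (sym (++-assoc (blocks s) block u)) (cong (_++ u) (blocks-∷ʳ s)))

  afterBlocks-rejects : ∀ s → RejectsEarlyOne p′ (afterBlocks s ∘ (true ∷_))
  afterBlocks-rejects s i<p′ = isV-short-gap i<p′ (blocks s)

  afterBlocks-0∧1 : ∀ {s} → s ≤ r → ∀ u →
    afterBlocks s (false ∷ u) ∧ afterBlocks s (true ∷ u) ≡ afterBlocks s (true ∷ u)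
  afterBlocks-0∧1 {s} s≤r u = begin
    afterBlocks s (false ∷ u) ∧ afterBlocks s (true ∷ u)
      ≡⟨ cong (_∧ afterBlocks s (true ∷ u)) (isV-blocks-0 s≤r u) ⟩
    isV u ∧ isV (blocks s ++ true ∷ u)
      ≡⟨ cong (λ w → isV u ∧ isV w) (++-assoc (blocks s) [ true ] u) ⟨
    isV u ∧ isV ((blocks s ++ [ true ]) ++ u)  ≡⟨ isV-∧-suffix (blocks s ++ [ true ]) u ⟩
    isV ((blocks s ++ [ true ]) ++ u)          ≡⟨ cong isV (++-assoc (blocks s) [ true ] u) ⟩
    afterBlocks s (true ∷ u)                   ∎
    where open ≡-Reasoning

  vertexCount-afterBlocks-0 : ∀ {s} → s ≤ r → ∀ m →
    vertexCount (afterBlocks s ∘ (false ∷_)) m ≡ numV p r m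
  vertexCount-afterBlocks-0 s≤r m =
    trans (vertexCount-cong (isV-blocks-0 s≤r) m) (sym (numV≡vertexCount p r m))

  edgeCount-afterBlocks-0 : ∀ {s} → s ≤ r → ∀ m →
    edgeCount (afterBlocks s ∘ (false ∷_)) m ≡ numE p r m
  edgeCount-afterBlocks-0 s≤r m =
    trans (edgeCount-cong (isV-blocks-0 s≤r) m) (sym (numE≡edgeCount p r m))

  vertexCount-afterBlocks-1 : ∀ s m →
    vertexCount (afterBlocks s ∘ (true ∷_)) (p′ + m) ≡ vertexCount (afterBlocks (suc s)) m
  vertexCount-afterBlocks-1 s m =
    trans (vertexCount-zeros p′ {afterBlocks s ∘ (true ∷_)} (afterBlocks-rejects s) m)
          (vertexCount-cong (afterBlocks-1 s) m)

  edgeCount-afterBlocks-1 : ∀ s m →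
    edgeCount (afterBlocks s ∘ (true ∷_)) (p′ + m) ≡ edgeCount (afterBlocks (suc s)) m
  edgeCount-afterBlocks-1 s m =
    trans (edgeCount-zeros p′ {afterBlocks s ∘ (true ∷_)} (afterBlocks-rejects s) m)
          (edgeCount-cong (afterBlocks-1 s) m)

  vertexCount-afterBlocks-suc : ∀ {s} → s ≤ r → ∀ m →
    vertexCount (afterBlocks s) (suc (p′ + m)) ≡ numV p r (p′ + m) + vertexCount (afterBlocks (suc s)) m
  vertexCount-afterBlocks-suc {s} s≤r m = trans (vertexCount-suc (afterBlocks s) (p′ + m))
    (cong₂ _+_ (vertexCount-afterBlocks-0 s≤r (p′ + m)) (vertexCount-afterBlocks-1 s m))

  edgeCount-afterBlocks-suc : ∀ {s} → s ≤ r → ∀ m → edgeCount (afterBlocks s) (suc (p′ + m)) ≡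
    numE p r (p′ + m) + vertexCount (afterBlocks (suc s)) m + edgeCount (afterBlocks (suc s)) m
  edgeCount-afterBlocks-suc {s} s≤r m = begin
    edgeCount (afterBlocks s) (suc (p′ + m))
      ≡⟨ edgeCount-suc (afterBlocks s) (p′ + m) ⟩
    edgeCount (afterBlocks s ∘ (false ∷_)) (p′ + m)
      + vertexCount (λ u → afterBlocks s (false ∷ u) ∧ afterBlocks s (true ∷ u)) (p′ + m)
      + edgeCount (afterBlocks s ∘ (true ∷_)) (p′ + m)
      ≡⟨ cong₂ (λ a b → edgeCount (afterBlocks s ∘ (false ∷_)) (p′ + m) + a + b)
           (trans (vertexCount-cong (afterBlocks-0∧1 s≤r) (p′ + m)) (vertexCount-afterBlocks-1 s m))
           (edgeCount-afterBlocks-1 s m) ⟩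
    edgeCount (afterBlocks s ∘ (false ∷_)) (p′ + m) + V₊ + E₊
      ≡⟨ cong (λ a → a + V₊ + E₊) (edgeCount-afterBlocks-0 s≤r (p′ + m)) ⟩
    numE p r (p′ + m) + V₊ + E₊ ∎
    where
    open ≡-Reasoning
    V₊ = vertexCount (afterBlocks (suc s)) m
    E₊ = edgeCount (afterBlocks (suc s)) m

  vertexCount-afterBlocks-r : ∀ m → vertexCount (afterBlocks r) (suc m) ≡ numV p r m
  vertexCount-afterBlocks-r m =
    trans (vertexCount-head-0 {afterBlocks r} isV-blocks-1 m) (vertexCount-afterBlocks-0 ≤-refl m)

  edgeCount-afterBlocks-r : ∀ m → edgeCount (afterBlocks r) (suc m) ≡ numE p r m
  edgeCount-afterBlocks-r m =
    trans (edgeCount-head-0 {afterBlocks r} isV-blocks-1 m) (edgeCount-afterBlocks-0 ≤-refl m)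

  s≤r : ∀ s k → s + k ≡ r → s ≤ r
  s≤r s k s+k≡r = subst (s ≤_) s+k≡r (m≤m+n s k)

  suc-s+k≡r : ∀ s k → s + suc k ≡ r → suc s + k ≡ r
  suc-s+k≡r s k = trans (sym (+-suc s k))

  ∸-shift : ∀ m t → suc (p′ + m) ∸ (suc t * p + 1) ≡ m ∸ (t * p + 1)
  ∸-shift m t = trans (cong ((p′ + m) ∸_) (+-assoc p′ (t * p) 1)) ([m+n]∸[m+o]≡n∸o p′ m (t * p + 1))

  vertexCount-afterBlocks : ∀ k {s} → s + k ≡ r → ∀ {m} → k * p < m →
    vertexCount (afterBlocks s) m ≡ sumTo k (λ t → numV p r (m ∸ (t * p + 1)))
  vertexCount-afterBlocks zero {s} s+0≡r {suc m} _ rewrite trans (sym (+-identityʳ s)) s+0≡r =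
    trans (vertexCount-afterBlocks-r m) (sym (+-identityʳ _))
  vertexCount-afterBlocks (suc k) {s} s+k+1≡r k+1*p<m with m+n<o⇒∃[o′]o≡m+o′×n<o′ p k+1*p<m
  ... | m′ , refl , k*p<m′ = begin
    vertexCount (afterBlocks s) (suc (p′ + m′))
      ≡⟨ vertexCount-afterBlocks-suc (s≤r s (suc k) s+k+1≡r) m′ ⟩
    V (p′ + m′) + vertexCount (afterBlocks (suc s)) m′
      ≡⟨ cong (V (p′ + m′) +_) (vertexCount-afterBlocks k (suc-s+k≡r s k s+k+1≡r) k*p<m′) ⟩
    V (p′ + m′) + sumTo k (λ t → V (m′ ∸ (t * p + 1)))
      ≡⟨ cong (V (p′ + m′) +_) (sumTo-cong k (λ t → cong V (∸-shift m′ t))) ⟨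
    V (p′ + m′) + sumTo k (λ t → V (suc (p′ + m′) ∸ (suc t * p + 1)))
      ≡⟨ sumTo-suc k (λ t → V (suc (p′ + m′) ∸ (t * p + 1))) ⟨
    sumTo (suc k) (λ t → V (suc (p′ + m′) ∸ (t * p + 1))) ∎
    where
    open ≡-Reasoning
    V = numV p r

  edgeCount-afterBlocks : ∀ k {s} → s + k ≡ r → ∀ {m} → k * p < m →
    edgeCount (afterBlocks s) m ≡
      sumTo k (λ t → numE p r (m ∸ (t * p + 1)) + t * numV p r (m ∸ (t * p + 1)))
  edgeCount-afterBlocks zero {s} s+0≡r {suc m} _ rewrite trans (sym (+-identityʳ s)) s+0≡r =
    trans (edgeCount-afterBlocks-r m) (sym (trans (+-identityʳ _) (+-identityʳ _)))
  edgeCount-afterBlocks (suc k) {s} s+k+1≡r k+1*p<m with m+n<o⇒∃[o′]o≡m+o′×n<o′ p k+1*p<m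
  ... | m′ , refl , k*p<m′ = begin
    edgeCount (afterBlocks s) (suc (p′ + m′))
      ≡⟨ edgeCount-afterBlocks-suc (s≤r s (suc k) s+k+1≡r) m′ ⟩
    E (p′ + m′) + vertexCount (afterBlocks (suc s)) m′ + edgeCount (afterBlocks (suc s)) m′
      ≡⟨ cong₂ (λ a b → E (p′ + m′) + a + b) (vertexCount-afterBlocks k s+1+k≡r k*p<m′)
                                               (edgeCount-afterBlocks k s+1+k≡r k*p<m′) ⟩
    E (p′ + m′) + sumTo k (V ∘ at m′) + sumTo k (EV m′)
      ≡⟨ +-assoc (E (p′ + m′)) _ _ ⟩
    E (p′ + m′) + (sumTo k (V ∘ at m′) + sumTo k (EV m′))
      ≡⟨ cong (E (p′ + m′) +_) (sum-map-+ (V ∘ at m′) (EV m′) (upTo (suc k))) ⟨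
    E (p′ + m′) + sumTo k (λ t → V (at m′ t) + EV m′ t)
      ≡⟨ cong (E (p′ + m′) +_) (sumTo-cong k shifted-term) ⟩
    E (p′ + m′) + sumTo k (EV (suc (p′ + m′)) ∘ suc)
      ≡⟨ cong (_+ sumTo k (EV (suc (p′ + m′)) ∘ suc)) (+-identityʳ (E (p′ + m′))) ⟨
    EV (suc (p′ + m′)) 0 + sumTo k (EV (suc (p′ + m′)) ∘ suc)
      ≡⟨ sumTo-suc k (EV (suc (p′ + m′))) ⟨
    sumTo (suc k) (EV (suc (p′ + m′))) ∎
    where
    open ≡-Reasoning
    V = numV p r
    E = numE p r
    at : ℕ → ℕ → ℕ
    at m t = m ∸ (t * p + 1)
    EV : ℕ → ℕ → ℕ
    EV m t = E (at m t) + t * V (at m t)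
    s+1+k≡r = suc-s+k≡r s k s+k+1≡r
    shifted-term : ∀ t → V (at m′ t) + EV m′ t ≡ EV (suc (p′ + m′)) (suc t)
    shifted-term t = trans (x∙yz≈y∙xz (V (at m′ t)) (E (at m′ t)) (t * V (at m′ t)))
      (cong (λ n → E n + suc t * V n) (sym (∸-shift m′ t)))

proposition2p8 : (p r n : ℕ) → 1 ≤ p → 1 ≤ r → p * r < n →
    numE p r n ≡ sumTo r (λ t → numE p r (n ∸ (t * p + 1)) + t * numV p r (n ∸ (t * p + 1)))
proposition2p8 (suc p′) r n _ _ p*r<n =
  trans (numE≡edgeCount (suc p′) r n) (edgeCount-afterBlocks r refl (subst (_< n) (*-comm (suc p′) r) p*r<n))
  where open Blocks p′ r
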